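{- Let $G$ be a strongly co-edge-regular graph with parameters $(n,k,2,\ell)$ and clique number $\omega$. If $\omega>\frac{\ell+4}{2}$, then $\ell=k-2$.
   Context: All graphs are finite, undirected and simple. A co-edge-regular graph with parameters $(n,k,c)$ is a $k$-regular graph on $n$ vertices, neither complete nor edgeless, in which any two distinct non-adjacent vertices have exactly $c$ common neighbours. For adjacent $x,y$, $a_{xy}$ is the number of common neighbours of $x,y$. A strongly co-edge-regular graph with parameters $(n,k,c,\ell)$ is a co-edge-regular graph with parameters $(n,k,c)$ such that for any two distinct non-adjacent vertices $x,z$, $\sum_{y\sim x,\,y\sim z}a_{xy}=\ell$. The clique number is the maximum size of a clique. -}

module Defs where

open import Level using (0ℓ)
open import Data.Nat using (ℕ)
open import Data.Fin using (Fin)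
open import Data.Fin.Subset using (Subset; _∈_; ∣_∣)
open import Data.List using (List; length; filter; map; allFin)
open import Data.Nat.ListAction using (sum)
open import Data.Product using (_×_; ∃; ∃-syntax; Σ-syntax)
open import Relation.Nullary using (¬_; Dec; yes; no)
open import Relation.Nullary.Decidable using (_×-dec_)
open import Relation.Binary using (Rel; Decidable; Symmetric; Irreflexive)
open import Relation.Binary.PropositionalEquality using (_≡_; _≢_)

record Graph (n : ℕ) : Set₁ where
  field
    Adj    : Rel (Fin n) 0ℓ
    adj?   : Decidable Adj
    sym    : Symmetric Adj
    irrefl : Irreflexive _≡_ Adj

module _ {n : ℕ} (G : Graph n) where
  open Graph G

  commonNbrs : Fin n → Fin n → List (Fin n)
  commonNbrs x z = filter (λ y → adj? x y ×-dec adj? z y) (allFin n)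

  degree : Fin n → ℕ
  degree x = length (filter (adj? x) (allFin n))

  a : Fin n → Fin n → ℕ
  a x y = length (commonNbrs x y)

  IsComplete : Set
  IsComplete = ∀ x y → x ≢ y → Adj x y

  IsEdgeless : Set
  IsEdgeless = ∀ x y → ¬ Adj x y

  IsCoEdgeRegular : ℕ → ℕ → Set
  IsCoEdgeRegular k c =
    (∀ x → degree x ≡ k) ×
    ¬ IsComplete ×
    ¬ IsEdgeless ×
    (∀ x z → x ≢ z → ¬ Adj x z → a x z ≡ c)

  -- parameters (n,k,c,ℓ); n is the number of vertices (the index of G)
  IsStronglyCoEdgeRegular : ℕ → ℕ → ℕ → Set
  IsStronglyCoEdgeRegular k c ℓ =
    IsCoEdgeRegular k c ×
    (∀ x z → x ≢ z → ¬ Adj x z → sum (map (a x) (commonNbrs x z)) ≡ ℓ)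

  IsClique : Subset n → Set
  IsClique S = ∀ x y → x ∈ S → y ∈ S → x ≢ y → Adj x y

  IsCliqueNumber : ℕ → Set
  IsCliqueNumber ω =
    (∃[ S ] (IsClique S × ∣ S ∣ ≡ ω)) ×
    (∀ S → IsClique S → ∣ S ∣ Data.Nat.≤ ω)

module Submission where

-- Let C be a maximum clique. Any two vertices x, y of C have the other ω - 2 vertices of C as
-- common neighbours, so a_xy ≥ ω - 2, and the hypothesis ℓ + 4 < 2ω says that two such numbers
-- always sum to more than ℓ. Applying the strong condition to non-adjacent pairs (which have
-- exactly two common neighbours), this forces every vertex outside C to have exactly one
-- neighbour in C, and any two outside vertices with a common neighbour in C to be adjacent.
-- So for x ∈ C, another y ∈ C and a neighbour u ∉ C of x, the neighbourhood of x is the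
-- disjoint union of {y}, {u}, the common neighbours of x and y, and those of x and u; hence
-- k = 2 + a_xy + a_xu, while the strong condition gives ℓ = a_xy + a_xu.

open import Defs
open import Level using (Level)
open import Data.Bool.Base using (if_then_else_)
open import Data.Nat using (ℕ; zero; suc; _+_; _*_; _≤_; _<_; z≤n; s≤s)
open import Data.Nat.Properties hiding (_≟_)
open import Data.Nat.ListAction using (sum)
open import Data.Nat.Tactic.RingSolver using (solve-∀)
open import Algebra.Properties.CommutativeMonoid.Sum +-0-commutativeMonoid
  using (∑-distrib-+; sum-cong-≗; sum-remove; sum-replicate-zero) renaming (sum to ∑)
open import Data.Fin using (Fin; zero; suc; _≟_; punchIn)
open import Data.Fin.Properties using (any?; ¬∀⟶∃¬; punchInᵢ≢i)
open import Data.Vec.Base using ([]; _∷_; here; there)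
open import Data.Fin.Subset using (Subset; inside; outside; _∈_; _∉_; ∣_∣; ⁅_⁆) renaming (_∪_ to _∪ₛ_)
open import Data.Fin.Subset.Properties using (_∈?_; ∪-identityˡ; x∈p∪q⁻; x∈⁅y⁆⇒x≡y)
open import Data.List using (length; filter; map; tabulate)
open import Data.Product using (_×_; _,_; ∃; swap)
open import Data.Sum using (inj₁; inj₂)
open import Data.Empty using (⊥-elim)
open import Function using (_∘_; id; const)
open import Relation.Nullary using (Dec; yes; no; does; ¬_; contradiction)
open import Relation.Nullary.Decidable using (_×-dec_; ¬?)
open import Relation.Unary using (Pred; Decidable; Satisfiable; _⊆_; _≐_; _∪_; _∩_; _∖_; _⊥_; ｛_｝)
open import Relation.Unary.Properties using (_∪?_; _∩?_; ∁?)
open import Relation.Binary.PropositionalEquality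
  using (_≡_; _≢_; refl; sym; trans; cong; cong₂; subst; module ≡-Reasoning)

private variable
  c p q r : Level
  A : Set c
  n : ℕ

select : {S : Set c} → Dec S → ℕ → ℕ
select d m = if does d then m else 0

sumWhere : {P : Pred (Fin n) p} → Decidable P → (Fin n → ℕ) → ℕ
sumWhere P? f = ∑ λ i → select (P? i) (f i)

count : {P : Pred (Fin n) p} → Decidable P → ℕ
count P? = sumWhere P? (const 1)

sum-map-filter-tabulate : {P : Pred A p} (P? : Decidable P) (f : A → ℕ) (g : Fin n → A) →
                          sum (map f (filter P? (tabulate g))) ≡ sumWhere (P? ∘ g) (f ∘ g)
sum-map-filter-tabulate {n = zero}  P? f g = refl
sum-map-filter-tabulate {n = suc n} P? f g with P? (g zero)
... | yes _ = cong (f (g zero) +_) (sum-map-filter-tabulate P? f (g ∘ suc))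
... | no _  = sum-map-filter-tabulate P? f (g ∘ suc)

length-filter-tabulate : {P : Pred A p} (P? : Decidable P) (g : Fin n → A) →
                         length (filter P? (tabulate g)) ≡ count (P? ∘ g)
length-filter-tabulate {n = zero}  P? g = refl
length-filter-tabulate {n = suc n} P? g with P? (g zero)
... | yes _ = cong suc (length-filter-tabulate P? (g ∘ suc))
... | no _  = length-filter-tabulate P? (g ∘ suc)

∣p∣≡count : (s : Subset n) → ∣ s ∣ ≡ count (_∈? s)
∣p∣≡count []            = refl
∣p∣≡count (inside ∷ s)  = cong suc (∣p∣≡count s)
∣p∣≡count (outside ∷ s) = ∣p∣≡count s

∣⁅x⁆∪p∣≡1+∣p∣ : {x : Fin n} {p : Subset n} → x ∉ p → ∣ ⁅ x ⁆ ∪ₛ p ∣ ≡ suc ∣ p ∣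
∣⁅x⁆∪p∣≡1+∣p∣ {x = zero}  {outside ∷ p} _   = cong (suc ∘ ∣_∣) (∪-identityˡ p)
∣⁅x⁆∪p∣≡1+∣p∣ {x = zero}  {inside ∷ p}  x∉p = contradiction here x∉p
∣⁅x⁆∪p∣≡1+∣p∣ {x = suc x} {outside ∷ p} x∉p = ∣⁅x⁆∪p∣≡1+∣p∣ (x∉p ∘ there)
∣⁅x⁆∪p∣≡1+∣p∣ {x = suc x} {inside ∷ p}  x∉p = cong suc (∣⁅x⁆∪p∣≡1+∣p∣ (x∉p ∘ there))

∑-mono-≤ : {f g : Fin n → ℕ} → (∀ i → f i ≤ g i) → ∑ f ≤ ∑ g
∑-mono-≤ {n = zero}  f≤g = z≤n
∑-mono-≤ {n = suc n} f≤g = +-mono-≤ (f≤g zero) (∑-mono-≤ (f≤g ∘ suc))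

sumWhere-∅ : {P : Pred (Fin n) p} (P? : Decidable P) (f : Fin n → ℕ) →
             (∀ i → ¬ P i) → sumWhere P? f ≡ 0
sumWhere-∅ {n = n} P? f ¬P = trans (sum-cong-≗ vanishes) (sum-replicate-zero n)
  where
  vanishes : ∀ i → select (P? i) (f i) ≡ 0
  vanishes i with P? i
  ... | yes Pi = contradiction Pi (¬P i)
  ... | no _   = refl

sumWhere-｛｝ : (y : Fin n) (f : Fin n → ℕ) → sumWhere (y ≟_) f ≡ f y
sumWhere-｛｝ {n = suc n} y f = begin
  sumWhere (y ≟_) f                                    ≡⟨ sum-remove {i = y} (λ i → select (y ≟ i) (f i)) ⟩
  select (y ≟ y) (f y) + sumWhere ((y ≟_) ∘ punchIn y) (f ∘ punchIn y)
                                                       ≡⟨ cong₂ _+_ selected rest ⟩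
  f y + 0                                              ≡⟨ +-identityʳ (f y) ⟩
  f y                                                  ∎
  where
  open ≡-Reasoning
  selected : select (y ≟ y) (f y) ≡ f y
  selected with y ≟ y
  ... | yes _   = refl
  ... | no y≢y = contradiction refl y≢y
  rest : sumWhere ((y ≟_) ∘ punchIn y) (f ∘ punchIn y) ≡ 0
  rest = sumWhere-∅ ((y ≟_) ∘ punchIn y) (f ∘ punchIn y) (λ j → punchInᵢ≢i y j ∘ sym)

module _ {n : ℕ} where

  private variable
    P : Pred (Fin n) p
    Q : Pred (Fin n) q
    R : Pred (Fin n) r

  sumWhere-mono : (P? : Decidable P) (Q? : Decidable Q) (f : Fin n → ℕ) →
                  P ⊆ Q → sumWhere P? f ≤ sumWhere Q? f
  sumWhere-mono P? Q? f P⊆Q = ∑-mono-≤ pointwise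
    where
    pointwise : ∀ i → select (P? i) (f i) ≤ select (Q? i) (f i)
    pointwise i with P? i | Q? i
    ... | yes _  | yes _ = ≤-refl
    ... | yes Pi | no ¬Qi = contradiction (P⊆Q Pi) ¬Qi
    ... | no _   | _      = z≤n

  sumWhere-cong : (P? : Decidable P) (Q? : Decidable Q) (f : Fin n → ℕ) →
                  P ≐ Q → sumWhere P? f ≡ sumWhere Q? f
  sumWhere-cong P? Q? f (P⊆Q , Q⊆P) =
    ≤-antisym (sumWhere-mono P? Q? f P⊆Q) (sumWhere-mono Q? P? f Q⊆P)

  sumWhere-∪ : (Q? : Decidable Q) (R? : Decidable R) (f : Fin n → ℕ) →
               Q ⊥ R → sumWhere (Q? ∪? R?) f ≡ sumWhere Q? f + sumWhere R? f
  sumWhere-∪ Q? R? f Q⊥R =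
    trans (sum-cong-≗ pointwise) (∑-distrib-+ (λ i → select (Q? i) (f i)) (λ i → select (R? i) (f i)))
    where
    pointwise : ∀ i → select ((Q? ∪? R?) i) (f i) ≡ select (Q? i) (f i) + select (R? i) (f i)
    pointwise i with Q? i | R? i
    ... | yes Qi | yes Ri = ⊥-elim (Q⊥R (Qi , Ri))
    ... | yes _  | no _   = sym (+-identityʳ (f i))
    ... | no _   | yes _  = refl
    ... | no _   | no _   = refl

  sumWhere-∪-≤ : (Q? : Decidable Q) (R? : Decidable R) (f : Fin n → ℕ) →
                 sumWhere (Q? ∪? R?) f ≤ sumWhere Q? f + sumWhere R? f
  sumWhere-∪-≤ Q? R? f = ≤-trans (∑-mono-≤ pointwise)
    (≤-reflexive (∑-distrib-+ (λ i → select (Q? i) (f i)) (λ i → select (R? i) (f i))))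
    where
    pointwise : ∀ i → select ((Q? ∪? R?) i) (f i) ≤ select (Q? i) (f i) + select (R? i) (f i)
    pointwise i with Q? i | R? i
    ... | yes _ | yes _ = m≤m+n (f i) (f i)
    ... | yes _ | no _  = m≤m+n (f i) 0
    ... | no _  | yes _ = ≤-refl
    ... | no _  | no _  = z≤n

  ∈⇒0<count : (P? : Decidable P) {y : Fin n} → P y → 0 < count P?
  ∈⇒0<count {P = P} P? {y} Py = begin
    1                ≡⟨ sumWhere-｛｝ y (const 1) ⟨
    count (y ≟_)     ≤⟨ sumWhere-mono (y ≟_) P? (const 1) (λ y≡v → subst P y≡v Py) ⟩
    count P?         ∎
    where open ≤-Reasoning

  0<count⇒satisfiable : (P? : Decidable P) → 0 < count P? → Satisfiable P
  0<count⇒satisfiable P? 0<count with any? P?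
  ... | yes ∃P = ∃P
  ... | no ∄P  = contradiction (sumWhere-∅ P? (const 1) (λ i Pi → ∄P (i , Pi))) (>⇒≢ 0<count)

  count-∖｛｝ : (P? : Decidable P) {y : Fin n} → P y → count P? ≡ 1 + count (P? ∩? ∁? (y ≟_))
  count-∖｛｝ {P = P} P? {y} Py = begin
    count P?                    ≡⟨ sumWhere-cong P? ((y ≟_) ∪? rest?) (const 1) (split , join) ⟩
    count ((y ≟_) ∪? rest?)     ≡⟨ sumWhere-∪ (y ≟_) rest? (const 1) (λ (y≡v , _ , y≢v) → y≢v y≡v) ⟩
    count (y ≟_) + count rest?  ≡⟨ cong (_+ count rest?) (sumWhere-｛｝ y (const 1)) ⟩
    1 + count rest?             ∎
    where
    open ≡-Reasoning
    rest? = P? ∩? ∁? (y ≟_)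
    split : P ⊆ ｛ y ｝ ∪ (P ∖ ｛ y ｝)
    split {v} Pv with y ≟ v
    ... | yes y≡v = inj₁ y≡v
    ... | no y≢v  = inj₂ (Pv , y≢v)
    join : ｛ y ｝ ∪ (P ∖ ｛ y ｝) ⊆ P
    join (inj₁ y≡v)      = subst P y≡v Py
    join (inj₂ (Pv , _)) = Pv

  1<count⇒another : (P? : Decidable P) {y : Fin n} → 1 < count P? → P y → Satisfiable (P ∖ ｛ y ｝)
  1<count⇒another P? 1<count Py =
    0<count⇒satisfiable (P? ∩? ∁? (_ ≟_)) (≤-pred (subst (1 <_) (count-∖｛｝ P? Py) 1<count))

  count≡2⇒⊆pair : (P? : Decidable P) {y₁ y₂ : Fin n} → count P? ≡ 2 →
                  y₁ ≢ y₂ → P y₁ → P y₂ → P ⊆ ｛ y₁ ｝ ∪ ｛ y₂ ｝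
  count≡2⇒⊆pair P? {y₁} {y₂} count≡2 y₁≢y₂ Py₁ Py₂ {v} Pv with y₁ ≟ v | y₂ ≟ v
  ... | yes y₁≡v | _        = inj₁ y₁≡v
  ... | no _     | yes y₂≡v = inj₂ y₂≡v
  ... | no y₁≢v  | no y₂≢v  = contradiction count≡2 (>⇒≢ (begin-strict
    2                                               <⟨ s≤s (s≤s (∈⇒0<count P₂? ((Pv , y₁≢v) , y₂≢v))) ⟩
    1 + (1 + count P₂?)                             ≡⟨ cong suc (count-∖｛｝ P₁? (Py₂ , y₁≢y₂)) ⟨
    1 + count P₁?                                   ≡⟨ count-∖｛｝ P? Py₁ ⟨
    count P?                                        ∎))
    where
    open ≤-Reasoning
    P₁? = P? ∩? ∁? (y₁ ≟_)
    P₂? = P₁? ∩? ∁? (y₂ ≟_)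

  count≡2⇒sumWhere : (P? : Decidable P) (f : Fin n → ℕ) {y₁ y₂ : Fin n} → count P? ≡ 2 →
                     y₁ ≢ y₂ → P y₁ → P y₂ → sumWhere P? f ≡ f y₁ + f y₂
  count≡2⇒sumWhere {P = P} P? f {y₁} {y₂} count≡2 y₁≢y₂ Py₁ Py₂ = begin
    sumWhere P? f                             ≡⟨ sumWhere-cong P? ((y₁ ≟_) ∪? (y₂ ≟_)) f (⊆pair , join) ⟩
    sumWhere ((y₁ ≟_) ∪? (y₂ ≟_)) f           ≡⟨ sumWhere-∪ (y₁ ≟_) (y₂ ≟_) f apart ⟩
    sumWhere (y₁ ≟_) f + sumWhere (y₂ ≟_) f   ≡⟨ cong₂ _+_ (sumWhere-｛｝ y₁ f) (sumWhere-｛｝ y₂ f) ⟩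
    f y₁ + f y₂                               ∎
    where
    open ≡-Reasoning
    ⊆pair = count≡2⇒⊆pair P? count≡2 y₁≢y₂ Py₁ Py₂
    join : ｛ y₁ ｝ ∪ ｛ y₂ ｝ ⊆ P
    join (inj₁ y₁≡v) = subst P y₁≡v Py₁
    join (inj₂ y₂≡v) = subst P y₂≡v Py₂
    apart : ｛ y₁ ｝ ⊥ ｛ y₂ ｝
    apart (y₁≡v , y₂≡v) = y₁≢y₂ (trans y₁≡v (sym y₂≡v))

x+y≡x+z≡y+z⇒≡x+x : ∀ {s} x y z → s ≡ x + y → s ≡ x + z → s ≡ y + z → s ≡ x + x
x+y≡x+z≡y+z⇒≡x+x {s} x y z s≡x+y s≡x+z s≡y+z = trans s≡x+y (cong (x +_) (sym x≡y))
  where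
  y≡z : y ≡ z
  y≡z = +-cancelˡ-≡ x y z (trans (sym s≡x+y) s≡x+z)
  x≡y : x ≡ y
  x≡y = +-cancelʳ-≡ y x y (trans (sym s≡x+y) (trans s≡y+z (cong (y +_) (sym y≡z))))

x+y≡y+z⇒x+x≤ : ∀ {s} x y z → s ≡ x + y → s ≡ y + z → z ≤ y → x + x ≤ s
x+y≡y+z⇒x+x≤ {s} x y z s≡x+y s≡y+z z≤y = begin
  x + x   ≡⟨ cong (x +_) z≡x ⟨
  x + z   ≤⟨ +-monoʳ-≤ x z≤y ⟩
  x + y   ≡⟨ s≡x+y ⟨
  s       ∎
  where
  open ≤-Reasoning
  z≡x : z ≡ x
  z≡x = +-cancelˡ-≡ y z x (trans (sym s≡y+z) (trans s≡x+y (+-comm x y)))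

module _ {n : ℕ} (G : Graph n) where
  open Graph G renaming (sym to adj-sym)

  a≡count : ∀ x z → a G x z ≡ count (adj? x ∩? adj? z)
  a≡count x z = length-filter-tabulate (adj? x ∩? adj? z) id

  degree≡count : ∀ x → degree G x ≡ count (adj? x)
  degree≡count x = length-filter-tabulate (adj? x) id

  sum-commonNbrs : ∀ x z (f : Fin n → ℕ) → sum (map f (commonNbrs G x z)) ≡ sumWhere (adj? x ∩? adj? z) f
  sum-commonNbrs x z f = sum-map-filter-tabulate (adj? x ∩? adj? z) f id

  a-sym : ∀ x y → a G x y ≡ a G y x
  a-sym x y = begin
    a G x y                    ≡⟨ a≡count x y ⟩
    count (adj? x ∩? adj? y)   ≡⟨ sumWhere-cong (adj? x ∩? adj? y) (adj? y ∩? adj? x) (const 1) (swap , swap) ⟩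
    count (adj? y ∩? adj? x)   ≡⟨ a≡count y x ⟨
    a G y x                    ∎
    where open ≡-Reasoning

module CoEdgeRegular₂ {n : ℕ} (G : Graph n) {ℓ : ℕ}
  (coedge : ∀ x z → x ≢ z → ¬ Graph.Adj G x z → a G x z ≡ 2)
  (strong : ∀ x z → x ≢ z → ¬ Graph.Adj G x z → sum (map (a G x) (commonNbrs G x z)) ≡ ℓ) where

  open Graph G renaming (sym to adj-sym)

  private variable
    x y z y₁ y₂ : Fin n

  count-commonNbrs : x ≢ z → ¬ Adj x z → count (adj? x ∩? adj? z) ≡ 2
  count-commonNbrs {x} {z} x≢z ¬xz = trans (sym (a≡count G x z)) (coedge x z x≢z ¬xz)

  commonNbr : x ≢ z → ¬ Adj x z → Satisfiable (Adj x ∩ Adj z)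
  commonNbr {x} {z} x≢z ¬xz =
    0<count⇒satisfiable (adj? x ∩? adj? z) (subst (0 <_) (sym (count-commonNbrs x≢z ¬xz)) (s≤s z≤n))

  another-commonNbr : x ≢ z → ¬ Adj x z → (Adj x ∩ Adj z) y → Satisfiable ((Adj x ∩ Adj z) ∖ ｛ y ｝)
  another-commonNbr {x} {z} x≢z ¬xz =
    1<count⇒another (adj? x ∩? adj? z) (subst (1 <_) (sym (count-commonNbrs x≢z ¬xz)) ≤-refl)

  commonNbrs⊆pair : x ≢ z → ¬ Adj x z → y₁ ≢ y₂ → (Adj x ∩ Adj z) y₁ → (Adj x ∩ Adj z) y₂ →
                    Adj x ∩ Adj z ⊆ ｛ y₁ ｝ ∪ ｛ y₂ ｝
  commonNbrs⊆pair {x} {z} x≢z ¬xz = count≡2⇒⊆pair (adj? x ∩? adj? z) (count-commonNbrs x≢z ¬xz)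

  ℓ≡a+a : x ≢ z → ¬ Adj x z → y₁ ≢ y₂ → (Adj x ∩ Adj z) y₁ → (Adj x ∩ Adj z) y₂ →
          ℓ ≡ a G x y₁ + a G x y₂
  ℓ≡a+a {x} {z} {y₁ = y₁} {y₂ = y₂} x≢z ¬xz y₁≢y₂ y₁∈ y₂∈ = begin
    ℓ                                        ≡⟨ strong x z x≢z ¬xz ⟨
    sum (map (a G x) (commonNbrs G x z))     ≡⟨ sum-commonNbrs G x z (a G x) ⟩
    sumWhere (adj? x ∩? adj? z) (a G x)
      ≡⟨ count≡2⇒sumWhere (adj? x ∩? adj? z) (a G x) (count-commonNbrs x≢z ¬xz) y₁≢y₂ y₁∈ y₂∈ ⟩
    a G x y₁ + a G x y₂                      ∎
    where open ≡-Reasoning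

module MaxClique {n : ℕ} (G : Graph n) {ℓ ω : ℕ}
  (coedge : ∀ x z → x ≢ z → ¬ Graph.Adj G x z → a G x z ≡ 2)
  (strong : ∀ x z → x ≢ z → ¬ Graph.Adj G x z → sum (map (a G x) (commonNbrs G x z)) ≡ ℓ)
  (C : Subset n) (C-clique : IsClique G C) (∣C∣≡ω : ∣ C ∣ ≡ ω)
  (C-maximum : ∀ S → IsClique G S → ∣ S ∣ ≤ ω)
  (ω-large : ℓ + 4 < 2 * ω) where

  open Graph G renaming (sym to adj-sym)
  open CoEdgeRegular₂ G coedge strong

  private variable
    x y z : Fin n

  ∈-∉⇒≢ : x ∈ C → z ∉ C → x ≢ z
  ∈-∉⇒≢ x∈C z∉C x≡z = z∉C (subst (_∈ C) x≡z x∈C)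

  C-other : x ∈ C → Satisfiable ((_∈ C) ∖ ｛ x ｝)
  C-other x∈C = 1<count⇒another (_∈? C) (subst (1 <_) ω≡count (<⇒≤ 2<ω)) x∈C
    where
    ω≡count : ω ≡ count (_∈? C)
    ω≡count = trans (sym ∣C∣≡ω) (∣p∣≡count C)
    2<ω : 2 < ω
    2<ω = *-cancelˡ-< 2 2 ω (≤-<-trans (m≤n+m 4 ℓ) ω-large)

  ω≤2+a : x ∈ C → y ∈ C → x ≢ y → ω ≤ 2 + a G x y
  ω≤2+a {x} {y} x∈C y∈C x≢y = begin
    ω
      ≡⟨ trans (sym ∣C∣≡ω) (∣p∣≡count C) ⟩
    count (_∈? C)
      ≤⟨ sumWhere-mono (_∈? C) cover? (const 1) cover ⟩
    count cover?
      ≤⟨ sumWhere-∪-≤ (x ≟_) ((y ≟_) ∪? xy?) (const 1) ⟩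
    count (x ≟_) + count ((y ≟_) ∪? xy?)
      ≤⟨ +-monoʳ-≤ (count (x ≟_)) (sumWhere-∪-≤ (y ≟_) xy? (const 1)) ⟩
    count (x ≟_) + (count (y ≟_) + count xy?)
      ≡⟨ cong₂ _+_ (sumWhere-｛｝ x (const 1)) (cong (_+ count xy?) (sumWhere-｛｝ y (const 1))) ⟩
    2 + count xy?
      ≡⟨ cong (2 +_) (a≡count G x y) ⟨
    2 + a G x y
      ∎
    where
    open ≤-Reasoning
    xy? = adj? x ∩? adj? y
    cover? = (x ≟_) ∪? (y ≟_) ∪? xy?
    cover : (_∈ C) ⊆ ｛ x ｝ ∪ (｛ y ｝ ∪ (Adj x ∩ Adj y))
    cover {v} v∈C with x ≟ v | y ≟ v
    ... | yes x≡v | _       = inj₁ x≡v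
    ... | no _    | yes y≡v = inj₂ (inj₁ y≡v)
    ... | no x≢v  | no y≢v  = inj₂ (inj₂ (C-clique x v x∈C v∈C x≢v , C-clique y v y∈C v∈C y≢v))

  ℓ<a+a : ∀ {x y x′ y′} → x ∈ C → y ∈ C → x ≢ y → x′ ∈ C → y′ ∈ C → x′ ≢ y′ →
          ℓ < a G x y + a G x′ y′
  ℓ<a+a {x} {y} {x′} {y′} x∈C y∈C x≢y x′∈C y′∈C x′≢y′ = +-cancelʳ-< 4 ℓ (d + d′) (begin-strict
    ℓ + 4                     <⟨ ω-large ⟩
    2 * ω                     ≤⟨ +-mono-≤ (ω≤2+a x∈C y∈C x≢y) (+-monoˡ-≤ 0 (ω≤2+a x′∈C y′∈C x′≢y′)) ⟩
    (2 + d) + ((2 + d′) + 0)  ≡⟨ rearrange d d′ ⟩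
    (d + d′) + 4              ∎)
    where
    open ≤-Reasoning
    d = a G x y
    d′ = a G x′ y′
    rearrange : ∀ p q → (2 + p) + ((2 + q) + 0) ≡ (p + q) + 4
    rearrange = solve-∀

  outside-non-nbr : z ∉ C → ∃ λ x → x ∈ C × ¬ Adj x z
  outside-non-nbr {z} z∉C with any? (λ x → x ∈? C ×-dec ¬? (adj? x z))
  ... | yes found = found
  ... | no none   = contradiction (subst (_≤ ω) ∣enlarged∣≡1+ω (C-maximum (⁅ z ⁆ ∪ₛ C) enlarged-clique)) 1+n≰n
    where
    ∣enlarged∣≡1+ω : ∣ ⁅ z ⁆ ∪ₛ C ∣ ≡ suc ω
    ∣enlarged∣≡1+ω = trans (∣⁅x⁆∪p∣≡1+∣p∣ z∉C) (cong suc ∣C∣≡ω)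
    C-adj-z : ∀ x → x ∈ C → Adj x z
    C-adj-z x x∈C with adj? x z
    ... | yes xz  = xz
    ... | no ¬xz  = contradiction (x , x∈C , ¬xz) none
    enlarged-clique : IsClique G (⁅ z ⁆ ∪ₛ C)
    enlarged-clique x y x∈ y∈ x≢y with x∈p∪q⁻ ⁅ z ⁆ C x∈ | x∈p∪q⁻ ⁅ z ⁆ C y∈
    ... | inj₁ x∈⁅z⁆ | inj₁ y∈⁅z⁆ = contradiction (trans (x∈⁅y⁆⇒x≡y z x∈⁅z⁆) (sym (x∈⁅y⁆⇒x≡y z y∈⁅z⁆))) x≢y
    ... | inj₁ x∈⁅z⁆ | inj₂ y∈C   = subst (λ w → Adj w y) (sym (x∈⁅y⁆⇒x≡y z x∈⁅z⁆)) (adj-sym (C-adj-z y y∈C))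
    ... | inj₂ x∈C   | inj₁ y∈⁅z⁆ = subst (Adj x) (sym (x∈⁅y⁆⇒x≡y z y∈⁅z⁆)) (C-adj-z x x∈C)
    ... | inj₂ x∈C   | inj₂ y∈C   = C-clique x y x∈C y∈C x≢y

  C-nbr-unique : ∀ {z y₁ y₂} → z ∉ C → y₁ ∈ C → y₂ ∈ C → Adj z y₁ → Adj z y₂ → y₁ ≡ y₂
  C-nbr-unique {z} {y₁} {y₂} z∉C y₁∈C y₂∈C zy₁ zy₂ with y₁ ≟ y₂ | outside-non-nbr z∉C
  ... | yes y₁≡y₂ | _            = y₁≡y₂
  ... | no y₁≢y₂  | x , x∈C , ¬xz =
    contradiction (ℓ≡a+a (∈-∉⇒≢ x∈C z∉C) ¬xz y₁≢y₂ (xy zy₁ y₁∈C , zy₁) (xy zy₂ y₂∈C , zy₂))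
                  (<⇒≢ (ℓ<a+a x∈C y₁∈C (x≢ zy₁) x∈C y₂∈C (x≢ zy₂)))
    where
    x≢ : ∀ {y} → Adj z y → x ≢ y
    x≢ zy x≡y = ¬xz (subst (λ w → Adj w z) (sym x≡y) (adj-sym zy))
    xy : ∀ {y} → Adj z y → y ∈ C → Adj x y
    xy zy y∈C = C-clique _ _ x∈C y∈C (x≢ zy)

  ℓ≡a+a-outside : ∀ {x y u} → x ∈ C → y ∈ C → x ≢ y → u ∉ C → Adj x u → ℓ ≡ a G x y + a G x u
  ℓ≡a+a-outside {x} {y} {u} x∈C y∈C x≢y u∉C xu with another-commonNbr u≢y ¬uy (adj-sym xu , yx)
    where
    u≢y : u ≢ y
    u≢y u≡y = u∉C (subst (_∈ C) (sym u≡y) y∈C)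
    ¬uy : ¬ Adj u y
    ¬uy uy = x≢y (C-nbr-unique u∉C x∈C y∈C (adj-sym xu) uy)
    yx : Adj y x
    yx = C-clique y x y∈C x∈C (x≢y ∘ sym)
  ... | p , (up , yp) , x≢p = ℓ≡a+a (∈-∉⇒≢ x∈C p∉C) ¬xp (∈-∉⇒≢ y∈C u∉C)
                                (C-clique x y x∈C y∈C x≢y , adj-sym yp) (xu , adj-sym up)
    where
    p∉C : p ∉ C
    p∉C p∈C = x≢p (C-nbr-unique u∉C x∈C p∈C (adj-sym xu) up)
    ¬xp : ¬ Adj x p
    ¬xp xp = x≢y (C-nbr-unique p∉C x∈C y∈C (adj-sym xp) (adj-sym yp))

  outside-has-C-nbr : z ∉ C → ∃ λ y → y ∈ C × Adj z y
  outside-has-C-nbr {z} z∉C with any? (λ y → y ∈? C ×-dec adj? z y)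
  ... | yes found = found
  ... | no none with outside-non-nbr z∉C
  ...   | x , x∈C , ¬xz with C-other x∈C | commonNbr (∈-∉⇒≢ x∈C z∉C) ¬xz
  ...     | y , y∈C , x≢y | u₁ , c₁ with another-commonNbr (∈-∉⇒≢ x∈C z∉C) ¬xz c₁
  ...       | u₂ , c₂ , u₁≢u₂ =
    contradiction (x+y≡x+z≡y+z⇒≡x+x (a G x y) (a G x u₁) (a G x u₂) (via-y u₁ c₁) (via-y u₂ c₂)
                     (ℓ≡a+a (∈-∉⇒≢ x∈C z∉C) ¬xz u₁≢u₂ c₁ c₂))
                  (<⇒≢ (ℓ<a+a x∈C y∈C x≢y x∈C y∈C x≢y))
    where
    via-y : ∀ u → (Adj x ∩ Adj z) u → ℓ ≡ a G x y + a G x u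
    via-y u (xu , zu) = ℓ≡a+a-outside x∈C y∈C x≢y (λ u∈C → none (u , u∈C , zu)) xu

  adj-of-two-common-outside : ∀ {x t p q} → x ∈ C → t ∉ C → p ∉ C → q ∉ C → p ≢ q →
                              (Adj x ∩ Adj t) p → (Adj x ∩ Adj t) q → Adj x t
  adj-of-two-common-outside {x} {t} x∈C t∉C p∉C q∉C p≢q cp cq with adj? x t | outside-has-C-nbr t∉C
  ... | yes xt  | _             = xt
  ... | no ¬xt  | c , c∈C , tc
        with commonNbrs⊆pair (∈-∉⇒≢ x∈C t∉C) ¬xt p≢q cp cq (C-clique x c x∈C c∈C x≢c , tc)
    where
    x≢c : x ≢ c
    x≢c x≡c = ¬xt (adj-sym (subst (Adj t) (sym x≡c) tc))
  ...   | inj₁ p≡c = contradiction (subst (_∈ C) (sym p≡c) c∈C) p∉C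
  ...   | inj₂ q≡c = contradiction (subst (_∈ C) (sym q≡c) c∈C) q∉C

  a-outside-≤ : ∀ {x u v} → x ∈ C → u ∉ C → v ∉ C → Adj x u → Adj x v → Adj u v → a G u v ≤ a G u x
  a-outside-≤ {x} {u} {v} x∈C u∉C v∉C xu xv uv = begin
    a G u v                     ≡⟨ a≡count G u v ⟩
    count (adj? u ∩? adj? v)    ≤⟨ sumWhere-mono (adj? u ∩? adj? v) ((x ≟_) ∪? rest?) (const 1) cover ⟩
    count ((x ≟_) ∪? rest?)     ≤⟨ sumWhere-∪-≤ (x ≟_) rest? (const 1) ⟩
    count (x ≟_) + count rest?  ≡⟨ cong (_+ count rest?) (sumWhere-｛｝ x (const 1)) ⟩
    1 + count rest?             ≡⟨ count-∖｛｝ (adj? u ∩? adj? x) (uv , xv) ⟨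
    count (adj? u ∩? adj? x)    ≡⟨ a≡count G u x ⟨
    a G u x                     ∎
    where
    open ≤-Reasoning
    rest? = (adj? u ∩? adj? x) ∩? ∁? (v ≟_)
    cover : Adj u ∩ Adj v ⊆ ｛ x ｝ ∪ ((Adj u ∩ Adj x) ∖ ｛ v ｝)
    cover {t} (ut , vt) with t ∈? C
    ... | yes t∈C = inj₁ (C-nbr-unique u∉C x∈C t∈C (adj-sym xu) ut)
    ... | no t∉C  = inj₂ ((ut , xt) , λ v≡t → irrefl v≡t vt)
      where
      xt : Adj x t
      xt = adj-of-two-common-outside x∈C t∉C u∉C v∉C (λ u≡v → irrefl u≡v uv) (xu , adj-sym ut) (xv , adj-sym vt)

  outside-nbrs-adjacent : ∀ {x u w} → x ∈ C → u ∉ C → w ∉ C → u ≢ w → Adj x u → Adj x w → Adj u w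
  outside-nbrs-adjacent {x} {u} {w} x∈C u∉C w∉C u≢w xu xw with adj? u w
  ... | yes uw  = uw
  ... | no ¬uw with another-commonNbr u≢w ¬uw (adj-sym xu , adj-sym xw) | C-other x∈C
  ...   | v , (uv , wv) , x≢v | y , y∈C , x≢y =
    contradiction (x+y≡y+z⇒x+x≤ (a G x y) (a G x u) (a G u v) (ℓ≡a+a-outside x∈C y∈C x≢y u∉C xu) ℓ≡ le)
                  (<⇒≱ (ℓ<a+a x∈C y∈C x≢y x∈C y∈C x≢y))
    where
    v∉C : v ∉ C
    v∉C v∈C = x≢v (C-nbr-unique u∉C x∈C v∈C (adj-sym xu) uv)
    xv : Adj x v
    xv = adj-of-two-common-outside x∈C v∉C u∉C w∉C u≢w (xu , adj-sym uv) (xw , adj-sym wv)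
    ℓ≡ : ℓ ≡ a G x u + a G u v
    ℓ≡ = trans (ℓ≡a+a u≢w ¬uw x≢v (adj-sym xu , adj-sym xw) (uv , wv)) (cong (_+ a G u v) (a-sym G u x))
    le : a G u v ≤ a G x u
    le = subst (a G u v ≤_) (a-sym G u x) (a-outside-≤ x∈C u∉C v∉C xu xv uv)

  module _ {x y u} (x∈C : x ∈ C) (y∈C : y ∈ C) (x≢y : x ≢ y) (u∉C : u ∉ C) (xu : Adj x u) where

    private
      u-nbr-x-only : ∀ {t} → t ∈ C → Adj u t → x ≡ t
      u-nbr-x-only t∈C ut = C-nbr-unique u∉C x∈C t∈C (adj-sym xu) ut

    nbrs-cover : Adj x ⊆ ｛ y ｝ ∪ (｛ u ｝ ∪ ((Adj x ∩ Adj y) ∪ (Adj x ∩ Adj u)))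
    nbrs-cover {t} xt with y ≟ t | u ≟ t | t ∈? C
    ... | yes y≡t | _       | _       = inj₁ y≡t
    ... | no _    | yes u≡t | _       = inj₂ (inj₁ u≡t)
    ... | no y≢t  | no _    | yes t∈C = inj₂ (inj₂ (inj₁ (xt , C-clique y t y∈C t∈C y≢t)))
    ... | no _    | no u≢t  | no t∉C  = inj₂ (inj₂ (inj₂ (xt , outside-nbrs-adjacent x∈C u∉C t∉C u≢t xu xt)))

    nbrs-join : ｛ y ｝ ∪ (｛ u ｝ ∪ ((Adj x ∩ Adj y) ∪ (Adj x ∩ Adj u))) ⊆ Adj x
    nbrs-join (inj₁ y≡t)                = subst (Adj x) y≡t (C-clique x y x∈C y∈C x≢y)
    nbrs-join (inj₂ (inj₁ u≡t))         = subst (Adj x) u≡t xu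
    nbrs-join (inj₂ (inj₂ (inj₁ (xt , _)))) = xt
    nbrs-join (inj₂ (inj₂ (inj₂ (xt , _)))) = xt

    y-apart : ｛ y ｝ ⊥ (｛ u ｝ ∪ ((Adj x ∩ Adj y) ∪ (Adj x ∩ Adj u)))
    y-apart (y≡t , inj₁ u≡t)                = u∉C (subst (_∈ C) (trans y≡t (sym u≡t)) y∈C)
    y-apart (y≡t , inj₂ (inj₁ (_ , yt)))    = irrefl y≡t yt
    y-apart (y≡t , inj₂ (inj₂ (_ , ut)))    = x≢y (u-nbr-x-only y∈C (subst (Adj u) (sym y≡t) ut))

    u-apart : ｛ u ｝ ⊥ ((Adj x ∩ Adj y) ∪ (Adj x ∩ Adj u))
    u-apart (u≡t , inj₁ (_ , yt)) = x≢y (u-nbr-x-only y∈C (adj-sym (subst (Adj y) (sym u≡t) yt)))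
    u-apart (u≡t , inj₂ (_ , ut)) = irrefl u≡t ut

    common-apart : (Adj x ∩ Adj y) ⊥ (Adj x ∩ Adj u)
    common-apart {t} ((xt , yt) , (_ , ut)) with t ∈? C
    ... | yes t∈C = irrefl (u-nbr-x-only t∈C ut) xt
    ... | no t∉C  = x≢y (C-nbr-unique t∉C x∈C y∈C (adj-sym xt) (adj-sym yt))

    degree≡2+a+a : degree G x ≡ 2 + (a G x y + a G x u)
    degree≡2+a+a = begin
      degree G x
        ≡⟨ degree≡count G x ⟩
      count (adj? x)
        ≡⟨ sumWhere-cong (adj? x) parts? (const 1) (nbrs-cover , nbrs-join) ⟩
      count parts?
        ≡⟨ sumWhere-∪ (y ≟_) ((u ≟_) ∪? xy? ∪? xu?) (const 1) y-apart ⟩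
      count (y ≟_) + count ((u ≟_) ∪? xy? ∪? xu?)
        ≡⟨ cong (_+ count ((u ≟_) ∪? xy? ∪? xu?)) (sumWhere-｛｝ y (const 1)) ⟩
      1 + count ((u ≟_) ∪? xy? ∪? xu?)
        ≡⟨ cong (1 +_) (sumWhere-∪ (u ≟_) (xy? ∪? xu?) (const 1) u-apart) ⟩
      1 + (count (u ≟_) + count (xy? ∪? xu?))
        ≡⟨ cong (λ m → 1 + (m + count (xy? ∪? xu?))) (sumWhere-｛｝ u (const 1)) ⟩
      2 + count (xy? ∪? xu?)
        ≡⟨ cong (2 +_) (sumWhere-∪ xy? xu? (const 1) common-apart) ⟩
      2 + (count xy? + count xu?)
        ≡⟨ cong (2 +_) (cong₂ _+_ (a≡count G x y) (a≡count G x u)) ⟨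
      2 + (a G x y + a G x u)
        ∎
      where
      open ≡-Reasoning
      xy? = adj? x ∩? adj? y
      xu? = adj? x ∩? adj? u
      parts? = (y ≟_) ∪? (u ≟_) ∪? xy? ∪? xu?

  degree≡ℓ+2 : ∀ {x u} → x ∈ C → u ∉ C → Adj x u → degree G x ≡ ℓ + 2
  degree≡ℓ+2 {x} {u} x∈C u∉C xu with C-other x∈C
  ... | y , y∈C , x≢y = begin
    degree G x               ≡⟨ degree≡2+a+a x∈C y∈C x≢y u∉C xu ⟩
    2 + (a G x y + a G x u)  ≡⟨ cong (2 +_) (ℓ≡a+a-outside x∈C y∈C x≢y u∉C xu) ⟨
    2 + ℓ                    ≡⟨ +-comm 2 ℓ ⟩
    ℓ + 2                    ∎
    where open ≡-Reasoning

  outside-vertex : ¬ IsComplete G → ∃ λ z → z ∉ C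
  outside-vertex ¬complete = ¬∀⟶∃¬ n (_∈ C) (_∈? C) λ all∈C →
    ¬complete (λ x y x≢y → C-clique x y (all∈C x) (all∈C y) x≢y)

theorem3p4 : (n : ℕ) (G : Graph n) (k ℓ ω : ℕ) → IsStronglyCoEdgeRegular G k 2 ℓ → IsCliqueNumber G ω → ℓ + 4 < 2 * ω → ℓ + 2 ≡ k
theorem3p4 n G k ℓ ω ((regular , ¬complete , _ , coedge) , strong) ((C , C-clique , ∣C∣≡ω) , C-maximum) ω-large =
  let open MaxClique G coedge strong C C-clique ∣C∣≡ω C-maximum ω-large
      z , z∉C     = outside-vertex ¬complete
      y , y∈C , zy = outside-has-C-nbr z∉C
  in trans (sym (degree≡ℓ+2 y∈C z∉C (Graph.sym G zy))) (regular y)
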